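{- There exists an absolute constant $p>0$ such that for any fixed integer $s\ge3$, for all sufficiently large $n$ and any $t\in\left[R^{ -1}(s,n)\log n,\ n\right]$, we have \[p\cdot \mathrm{RT}(s,t/\log n,n)\le g(n;s,t).\]
   Context: $R^{ -1}(s,n)$ (the inverse Ramsey number) is the minimum independence number of a $K_s$-free graph on $n$ vertices. A red/blue/purple colouring of $K_n$ is a partition $R\cup B\cup P$ of its edge set. For integers $s,t\ge2$ and $n<R(s,t)$, $g(n;s,t)$ is the largest integer $g$ such that some red/blue/purple colouring of $K_n$ has $|P|=g$, $R\cup P$ is $K_s$-free and $B\cup P$ is $K_t$-free; for non-integer arguments $g(n;s,t):=g(n;\lceil s\rceil,\lceil t\rceil)$. $\mathrm{RT}(s,t,n)$ is the maximum number of edges in an $n$-vertex $K_s$-free graph with independence number less than $t$ (for real $t$). Logarithms are base 2.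
   Formalization: The parameter t ranges over the positive rationals instead of the reals, and the constant p is taken in the positive rationals. -}

module Defs where

open import Data.Nat using (ℕ; zero; suc; _+_; _*_; _^_; _≤_; _<_; _<ᵇ_)
open import Data.Nat.DivMod using (_/_)
open import Data.Fin using (Fin; toℕ)
open import Data.List using (List; map; allFin)
open import Data.Nat.ListAction using (sum)
open import Data.Bool using (Bool; true; false; if_then_else_; _∧_)
open import Data.Product using (Σ; ∃; ∃-syntax; _×_; _,_)
open import Data.Sum using (_⊎_)
open import Relation.Binary.PropositionalEquality using (_≡_; _≢_)
open import Function.Definitions using (Injective)

countPairs : {n : ℕ} → (Fin n → Fin n → Bool) → ℕ
countPairs {n} P =
  sum (map (λ i → sum (map (λ j → if (toℕ i <ᵇ toℕ j) ∧ P i j then 1 else 0)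
                           (allFin n)))
           (allFin n))

-- A (simple) graph on vertex set Fin n: symmetric boolean adjacency
-- (the diagonal is ignored everywhere).
record Graph (n : ℕ) : Set where
  field
    adj : Fin n → Fin n → Bool
    sym : ∀ i j → adj i j ≡ adj j i
open Graph public

edges : {n : ℕ} → Graph n → ℕ
edges G = countPairs (adj G)

HasClique : {n : ℕ} → (Fin n → Fin n → Set) → ℕ → Set
HasClique {n} E k =
  Σ (Fin k → Fin n) λ f → Injective _≡_ _≡_ f × (∀ i j → i ≢ j → E (f i) (f j))

KFree : {n : ℕ} → (Fin n → Fin n → Set) → ℕ → Set
KFree E s = HasClique E s → Data.Empty.⊥
  where import Data.Empty

Adj : {n : ℕ} → Graph n → Fin n → Fin n → Set
Adj G i j = adj G i j ≡ true

NonAdj : {n : ℕ} → Graph n → Fin n → Fin n → Set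
NonAdj G i j = adj G i j ≡ false

GKFree : {n : ℕ} → Graph n → ℕ → Set
GKFree G s = KFree (Adj G) s

IsIndepNum : {n : ℕ} → Graph n → ℕ → Set
IsIndepNum G k = HasClique (NonAdj G) k × (∀ j → HasClique (NonAdj G) j → j ≤ k)

IsInvRamsey : ℕ → ℕ → ℕ → Set
IsInvRamsey s n m =
  (Σ (Graph n) λ G → GKFree G s × IsIndepNum G m) ×
  (∀ (G : Graph n) k → GKFree G s → IsIndepNum G k → m ≤ k)

-- t is the positive rational a / (b+1).
-- "α < t / log₂ n" ⇔ α·log₂ n < a/(b+1) ⇔ n^(α(b+1)) < 2^a.
IndepBelow : (n a b k : ℕ) → Set
IndepBelow n a b k = n ^ (k * suc b) < 2 ^ a

RTAdmissible : (s n a b : ℕ) → Graph n → Set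
RTAdmissible s n a b G = GKFree G s × (∀ k → IsIndepNum G k → IndepBelow n a b k)

IsRT : (s n a b : ℕ) → ℕ → Set
IsRT s n a b r =
  (Σ (Graph n) λ G → RTAdmissible s n a b G × edges G ≡ r) ×
  (∀ (G : Graph n) → RTAdmissible s n a b G → edges G ≤ r)

data Colour : Set where
  red blue purple : Colour

record Colouring (n : ℕ) : Set where
  field
    col : Fin n → Fin n → Colour
    csym : ∀ i j → col i j ≡ col j i
open Colouring public

isPurple : Colour → Bool
isPurple purple = true
isPurple _ = false

purpleCount : {n : ℕ} → Colouring n → ℕ
purpleCount c = countPairs (λ i j → isPurple (col c i j))

RedOrPurple BlueOrPurple : {n : ℕ} → Colouring n → Fin n → Fin n → Set
RedOrPurple c i j = col c i j ≡ red ⊎ col c i j ≡ purple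
BlueOrPurple c i j = col c i j ≡ blue ⊎ col c i j ≡ purple

GAdmissible : (n s t : ℕ) → Colouring n → Set
GAdmissible n s t c = KFree (RedOrPurple c) s × KFree (BlueOrPurple c) t

IsG : (n s t : ℕ) → ℕ → Set
IsG n s t v =
  (Σ (Colouring n) λ c → GAdmissible n s t c × purpleCount c ≡ v) ×
  (∀ (c : Colouring n) → GAdmissible n s t c → purpleCount c ≤ v)

ceilFrac : ℕ → ℕ → ℕ
ceilFrac a b = (a + b) / suc b

{-# OPTIONS --safe #-}
-- Let G be extremal for RT(s, t/log n, n) and α its independence number, so α log n < t.
-- Take a cut of G containing at least half of its edges (built greedily: each vertex joins
-- the side that cuts the majority of its edges to the vertices already placed) and colour
-- the cut edges purple, the other edges red and the non-edges blue. Then R ∪ P = G is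
-- K_s-free, and a clique of B ∪ P meets each side in an independent set of G, so it has at
-- most 2α < t vertices as soon as log n ≥ 2. Hence p = 1/2 and n ≥ 4 suffice.
module Submission where

open import Defs
open import Data.Nat using (ℕ; suc; _+_; _*_; _^_; _≤_; _<_)
open import Data.Product using (Σ; ∃; ∃-syntax; _×_; _,_)

open import Data.Bool using (Bool; true; false; not; _∧_; _xor_; if_then_else_)
open import Data.Bool.Properties using (not-injective; xor-comm; xor-same)
open import Data.Fin using (Fin; zero; suc; toℕ)
open import Data.Fin.Properties using (suc-injective; injective⇒≤)
open import Data.List using (map; allFin; tabulate)
open import Data.List.Properties using (map-tabulate)
open import Data.Nat using (zero; z≤n; s≤s; _<ᵇ_; _≤ᵇ_; NonZero)
open import Data.Nat.DivMod using (_/_; m*n/n≡m; /-monoˡ-≤)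
open import Data.Nat.ListAction using (sum)
open import Data.Nat.Properties hiding (suc-injective)
open import Data.Product using (proj₂; ∃₂)
open import Data.Sum using (_⊎_; inj₁; inj₂)
open import Function using (_∘_; id)
open import Function.Definitions using (Injective)
open import Relation.Binary.PropositionalEquality
  using (_≡_; refl; trans; cong; cong₂; subst; module ≡-Reasoning)
import Relation.Binary.PropositionalEquality as ≡
open import Relation.Nullary using (¬_)
open import Relation.Nullary.Reflects using (ofʸ; ofⁿ)
open import Algebra.Properties.CommutativeMonoid.Sum +-0-commutativeMonoid
  using (sum-syntax; sum-cong-≗; ∑-distrib-+)

[_] : Bool → ℕ
[ b ] = if b then 1 else 0

sum-tabulate : ∀ {n} (h : Fin n → ℕ) → sum (tabulate h) ≡ ∑[ i < n ] h i
sum-tabulate {zero} h = refl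
sum-tabulate {suc n} h = cong (h zero +_) (sum-tabulate (h ∘ suc))

sum-map-allFin : ∀ {n} (h : Fin n → ℕ) → sum (map h (allFin n)) ≡ ∑[ i < n ] h i
sum-map-allFin h = trans (cong sum (map-tabulate id h)) (sum-tabulate h)

countPairs-∑ : ∀ {n} (P : Fin n → Fin n → Bool) →
  countPairs P ≡ ∑[ i < n ] ∑[ j < n ] [ (toℕ i <ᵇ toℕ j) ∧ P i j ]
countPairs-∑ {n} P =
  trans (sum-map-allFin (λ i → sum (map (ordered i) (allFin n))))
        (sum-cong-≗ (λ i → sum-map-allFin (ordered i)))
  where
  ordered : Fin n → Fin n → ℕ
  ordered i j = [ (toℕ i <ᵇ toℕ j) ∧ P i j ]

countPairs-cong : ∀ {n} {P Q : Fin n → Fin n → Bool} → (∀ i j → P i j ≡ Q i j) →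
  countPairs P ≡ countPairs Q
countPairs-cong {n} {P} {Q} P≗Q = begin
  countPairs P
    ≡⟨ countPairs-∑ P ⟩
  ∑[ i < n ] ∑[ j < n ] [ (toℕ i <ᵇ toℕ j) ∧ P i j ]
    ≡⟨ sum-cong-≗ (λ i → sum-cong-≗ (λ j → cong (λ b → [ (toℕ i <ᵇ toℕ j) ∧ b ]) (P≗Q i j))) ⟩
  ∑[ i < n ] ∑[ j < n ] [ (toℕ i <ᵇ toℕ j) ∧ Q i j ]
    ≡⟨ countPairs-∑ Q ⟨
  countPairs Q ∎
  where open ≡-Reasoning

countPairs-suc : ∀ {n} (P : Fin (suc n) → Fin (suc n) → Bool) →
  countPairs P ≡ ∑[ j < n ] [ P zero (suc j) ] + countPairs (λ i j → P (suc i) (suc j))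
countPairs-suc {n} P =
  trans (countPairs-∑ P) (cong (∑[ j < n ] [ P zero (suc j) ] +_) (≡.sym (countPairs-∑ P⁺)))
  where
  P⁺ : Fin n → Fin n → Bool
  P⁺ i j = P (suc i) (suc j)

cut : ∀ {n} → (Fin n → Fin n → Bool) → (Fin n → Bool) → Fin n → Fin n → Bool
cut P S i j = P i j ∧ (S i xor S j)

crossings : ∀ {n} → (Fin n → Bool) → (Fin n → Bool) → Bool → ℕ
crossings {n} row S b = ∑[ j < n ] [ row j ∧ (b xor S j) ]

bestSide : ∀ {n} → (Fin n → Bool) → (Fin n → Bool) → Bool
bestSide row S = crossings row S false ≤ᵇ crossings row S true

+-≤-2*larger : ∀ (c : Bool → ℕ) → c false + c true ≤ 2 * c (c false ≤ᵇ c true)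
+-≤-2*larger c with c false ≤ᵇ c true | ≤ᵇ-reflects-≤ (c false) (c true)
... | true  | ofʸ x≤y = begin
  c false + c true       ≤⟨ +-monoˡ-≤ (c true) x≤y ⟩
  c true + c true        ≡⟨ cong (c true +_) (+-identityʳ (c true)) ⟨
  2 * c true             ∎
  where open ≤-Reasoning
... | false | ofⁿ x≰y = begin
  c false + c true       ≤⟨ +-monoʳ-≤ (c false) (<⇒≤ (≰⇒> x≰y)) ⟩
  c false + c false      ≡⟨ cong (c false +_) (+-identityʳ (c false)) ⟨
  2 * c false            ∎
  where open ≤-Reasoning

[]-split : ∀ r s → [ r ] ≡ [ r ∧ s ] + [ r ∧ not s ]
[]-split true true = refl
[]-split true false = refl
[]-split false s = refl

degree-split : ∀ {n} (row S : Fin n → Bool) →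
  ∑[ j < n ] [ row j ] ≡ crossings row S false + crossings row S true
degree-split row S =
  trans (sum-cong-≗ (λ j → []-split (row j) (S j)))
        (∑-distrib-+ (λ j → [ row j ∧ S j ]) (λ j → [ row j ∧ not (S j) ]))

degree-≤-2*crossings : ∀ {n} (row S : Fin n → Bool) →
  ∑[ j < n ] [ row j ] ≤ 2 * crossings row S (bestSide row S)
degree-≤-2*crossings row S =
  subst (_≤ 2 * crossings row S (bestSide row S)) (≡.sym (degree-split row S))
        (+-≤-2*larger (crossings row S))

greedyCut : ∀ {n} → (Fin n → Fin n → Bool) → Fin n → Bool
greedyCut {suc n} P zero = bestSide (λ j → P zero (suc j)) (greedyCut (λ i j → P (suc i) (suc j)))
greedyCut {suc n} P (suc i) = greedyCut (λ i j → P (suc i) (suc j)) i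

countPairs-≤-2*cut : ∀ {n} (P : Fin n → Fin n → Bool) →
  countPairs P ≤ 2 * countPairs (cut P (greedyCut P))
countPairs-≤-2*cut {zero} P = z≤n
countPairs-≤-2*cut {suc n} P = begin
  countPairs P
    ≡⟨ countPairs-suc P ⟩
  ∑[ j < n ] [ row j ] + countPairs P⁺
    ≤⟨ +-mono-≤ (degree-≤-2*crossings row S⁺) (countPairs-≤-2*cut P⁺) ⟩
  2 * crossings row S⁺ (bestSide row S⁺) + 2 * countPairs (cut P⁺ S⁺)
    ≡⟨ *-distribˡ-+ 2 (crossings row S⁺ (bestSide row S⁺)) (countPairs (cut P⁺ S⁺)) ⟨
  2 * (crossings row S⁺ (bestSide row S⁺) + countPairs (cut P⁺ S⁺))
    ≡⟨ cong (2 *_) (countPairs-suc (cut P (greedyCut P))) ⟨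
  2 * countPairs (cut P (greedyCut P)) ∎
  where
  open ≤-Reasoning
  P⁺ : Fin n → Fin n → Bool
  P⁺ i j = P (suc i) (suc j)
  row : Fin n → Bool
  row j = P zero (suc j)
  S⁺ : Fin n → Bool
  S⁺ = greedyCut P⁺

HasClique-mono : ∀ {n k} {E F : Fin n → Fin n → Set} →
  (∀ i j → E i j → F i j) → HasClique E k → HasClique F k
HasClique-mono E⇒F (f , f-inj , clique) = f , f-inj , λ i j i≢j → E⇒F (f i) (f j) (clique i j i≢j)

KFree-mono : ∀ {n s} {E F : Fin n → Fin n → Set} →
  (∀ i j → E i j → F i j) → KFree F s → KFree E s
KFree-mono E⇒F F-free = F-free ∘ HasClique-mono E⇒F

HasClique⇒≤ : ∀ {n k} {E : Fin n → Fin n → Set} → HasClique E k → k ≤ n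
HasClique⇒≤ (_ , f-inj , _) = injective⇒≤ f-inj

HasClique-0 : ∀ {n} {E : Fin n → Fin n → Set} → HasClique E 0
HasClique-0 = (λ ()) , (λ {i} → λ {}) , λ ()

count : ∀ {k} → (Fin k → Bool) → ℕ
count {k} p = ∑[ i < k ] [ p i ]

count+count-not : ∀ {k} (p : Fin k → Bool) → count p + count (not ∘ p) ≡ k
count+count-not {zero} p = refl
count+count-not {suc k} p with p zero
... | true = cong suc (count+count-not (p ∘ suc))
... | false = trans (+-suc (count (p ∘ suc)) _) (cong suc (count+count-not (p ∘ suc)))

trueIndex : ∀ {k} (p : Fin k → Bool) → Fin (count p) → Fin k
trueIndex {suc k} p i with p zero
trueIndex {suc k} p zero    | true = zero
trueIndex {suc k} p (suc i) | true = suc (trueIndex (p ∘ suc) i)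
... | false = suc (trueIndex (p ∘ suc) i)

trueIndex-true : ∀ {k} (p : Fin k → Bool) i → p (trueIndex p i) ≡ true
trueIndex-true {suc k} p i with p zero in p₀
trueIndex-true {suc k} p zero    | true = p₀
trueIndex-true {suc k} p (suc i) | true = trueIndex-true (p ∘ suc) i
... | false = trueIndex-true (p ∘ suc) i

trueIndex-injective : ∀ {k} (p : Fin k → Bool) → Injective _≡_ _≡_ (trueIndex p)
trueIndex-injective {suc k} p {i} {j} with p zero
trueIndex-injective {suc k} p {zero}  {zero}  | true = λ _ → refl
trueIndex-injective {suc k} p {suc i} {suc j} | true =
  cong suc ∘ trueIndex-injective (p ∘ suc) ∘ suc-injective
trueIndex-injective {suc k} p {zero}  {suc j} | true = λ ()
trueIndex-injective {suc k} p {suc i} {zero}  | true = λ ()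
... | false = trueIndex-injective (p ∘ suc) ∘ suc-injective

Monochromatic : ∀ {n} → (Fin n → Bool) → (Fin n → Fin n → Set) → Fin n → Fin n → Set
Monochromatic S E i j = S i ≡ S j × E i j

HasClique-split : ∀ {n k} {E : Fin n → Fin n → Set} (S : Fin n → Bool) → HasClique E k →
  ∃₂ λ k₁ k₂ → k₁ + k₂ ≡ k × HasClique (Monochromatic S E) k₁ × HasClique (Monochromatic S E) k₂
HasClique-split {E = E} S (f , f-inj , edges) =
  count side , count (not ∘ side) , count+count-not side ,
  fibre side (λ i j → trans (trueIndex-true side i) (≡.sym (trueIndex-true side j))) ,
  fibre (not ∘ side)
    (λ i j → not-injective (trans (trueIndex-true (not ∘ side) i) (≡.sym (trueIndex-true (not ∘ side) j))))
  where
  side : Fin _ → Bool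
  side = S ∘ f
  fibre : (p : Fin _ → Bool) → (∀ i j → side (trueIndex p i) ≡ side (trueIndex p j)) →
    HasClique (Monochromatic S E) (count p)
  fibre p same-side =
    f ∘ trueIndex p , trueIndex-injective p ∘ f-inj ,
    λ i j i≢j → same-side i j , edges (trueIndex p i) (trueIndex p j) (i≢j ∘ trueIndex-injective p)

¬¬-maximum : ∀ {n} (Q : ℕ → Set) → Q 0 → (∀ j → Q j → j ≤ n) →
  ¬ ¬ (∃[ k ] (Q k × ∀ j → Q j → j ≤ k))
¬¬-maximum {n} Q q₀ bounded no-maximum =
  witness-from (suc n) λ (k , n<k , qk) → <⇒≱ n<k (bounded k qk)
  where
  witness-from : ∀ m → ¬ ¬ (∃[ k ] (m ≤ k × Q k))
  witness-from zero none = none (0 , z≤n , q₀)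
  witness-from (suc m) none = witness-from m λ (k , m≤k , qk) →
    no-maximum (k , qk , λ j qj → ≮⇒≥ λ k<j → none (j , ≤-trans (s≤s m≤k) k<j , qj))

¬¬-IsIndepNum : ∀ {n} (G : Graph n) → ¬ ¬ (∃[ α ] IsIndepNum G α)
¬¬-IsIndepNum G =
  ¬¬-maximum (HasClique (NonAdj G)) (HasClique-0 {E = NonAdj G}) (λ _ → HasClique⇒≤ {E = NonAdj G})

cutColour : Bool → Bool → Colour
cutColour false _ = blue
cutColour true false = red
cutColour true true = purple

cutColouring : ∀ {n} → Graph n → (Fin n → Bool) → Colouring n
cutColouring G S = record
  { col = λ i j → cutColour (adj G i j) (S i xor S j)
  ; csym = λ i j → cong₂ cutColour (Graph.sym G i j) (xor-comm (S i) (S j))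
  }

isPurple-cutColour : ∀ e x → isPurple (cutColour e x) ≡ e ∧ x
isPurple-cutColour false x = refl
isPurple-cutColour true false = refl
isPurple-cutColour true true = refl

purpleCount-cutColouring : ∀ {n} (G : Graph n) (S : Fin n → Bool) →
  purpleCount (cutColouring G S) ≡ countPairs (cut (adj G) S)
purpleCount-cutColouring G S =
  countPairs-cong (λ i j → isPurple-cutColour (adj G i j) (S i xor S j))

redOrPurple⇒Adj : ∀ {n} (G : Graph n) (S : Fin n → Bool) i j →
  RedOrPurple (cutColouring G S) i j → Adj G i j
redOrPurple⇒Adj G S i j = edge (adj G i j) (S i xor S j)
  where
  edge : ∀ e x → cutColour e x ≡ red ⊎ cutColour e x ≡ purple → e ≡ true
  edge true x _ = refl
  edge false x (inj₁ ())
  edge false x (inj₂ ())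

monochromatic-blueOrPurple⇒NonAdj : ∀ {n} (G : Graph n) (S : Fin n → Bool) i j →
  Monochromatic S (BlueOrPurple (cutColouring G S)) i j → NonAdj G i j
monochromatic-blueOrPurple⇒NonAdj G S i j (Si≡Sj , blueOrPurple) =
  nonEdge (adj G i j) (subst (λ x → BlueOrPurple′ (cutColour (adj G i j) x)) crossing≡false blueOrPurple)
  where
  BlueOrPurple′ : Colour → Set
  BlueOrPurple′ c = c ≡ blue ⊎ c ≡ purple
  crossing≡false : S i xor S j ≡ false
  crossing≡false = trans (cong (S i xor_) (≡.sym Si≡Sj)) (xor-same (S i))
  nonEdge : ∀ e → BlueOrPurple′ (cutColour e false) → e ≡ false
  nonEdge false _ = refl
  nonEdge true (inj₁ ())
  nonEdge true (inj₂ ())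

cutColouring-blueOrPurple-free : ∀ {n α t} (G : Graph n) (S : Fin n → Bool) →
  (∀ k → HasClique (NonAdj G) k → k ≤ α) → 2 * α < t →
  KFree (BlueOrPurple (cutColouring G S)) t
cutColouring-blueOrPurple-free {α = α} {t} G S α-bound 2α<t clique
  with HasClique-split {E = BlueOrPurple (cutColouring G S)} S clique
... | k₁ , k₂ , k₁+k₂≡t , clique₁ , clique₂ = <⇒≱ 2α<t (begin
  t                  ≡⟨ k₁+k₂≡t ⟨
  k₁ + k₂            ≤⟨ +-mono-≤ (independent clique₁) (independent clique₂) ⟩
  α + α              ≡⟨ cong (α +_) (+-identityʳ α) ⟨
  2 * α              ∎)
  where
  open ≤-Reasoning
  independent : ∀ {k} → HasClique (Monochromatic S (BlueOrPurple (cutColouring G S))) k → k ≤ α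
  independent = α-bound _ ∘ HasClique-mono {F = NonAdj G} (monochromatic-blueOrPurple⇒NonAdj G S)

^-cancelˡ-< : ∀ m .{{_ : NonZero m}} {x y} → m ^ x < m ^ y → x < y
^-cancelˡ-< m mˣ<mʸ = ≰⇒> (λ y≤x → <⇒≱ mˣ<mʸ (^-monoʳ-≤ m y≤x))

<-ceilFrac : ∀ {m} a b → m * suc b < a → m < ceilFrac a b
<-ceilFrac {m} a b m[b+1]<a = begin
  suc m                  ≡⟨ m*n/n≡m (suc m) (suc b) ⟨
  suc m * suc b / suc b  ≤⟨ /-monoˡ-≤ (suc b) [m+1][b+1]≤a+b ⟩
  (a + b) / suc b        ∎
  where
  open ≤-Reasoning
  [m+1][b+1]≤a+b : suc m * suc b ≤ a + b
  [m+1][b+1]≤a+b = begin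
    suc b + m * suc b    ≡⟨ +-comm (suc b) (m * suc b) ⟩
    m * suc b + suc b    ≡⟨ +-suc (m * suc b) b ⟩
    suc (m * suc b) + b  ≤⟨ +-monoˡ-≤ b m[b+1]<a ⟩
    a + b                ∎

IndepBelow⇒2*<ceilFrac : ∀ {n α} a b → 4 ≤ n → IndepBelow n a b α → 2 * α < ceilFrac a b
IndepBelow⇒2*<ceilFrac {n} {α} a b 4≤n below = <-ceilFrac a b (^-cancelˡ-< 2 (begin-strict
  2 ^ (2 * α * suc b)    ≡⟨ cong (2 ^_) (*-assoc 2 α (suc b)) ⟩
  2 ^ (2 * (α * suc b))  ≡⟨ ^-*-assoc 2 2 (α * suc b) ⟨
  4 ^ (α * suc b)        ≤⟨ ^-monoˡ-≤ (α * suc b) 4≤n ⟩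
  n ^ (α * suc b)        <⟨ below ⟩
  2 ^ a                  ∎))
  where open ≤-Reasoning

cutColouring-admissible : ∀ {s n} a b (G : Graph n) → 4 ≤ n → RTAdmissible s n a b G →
  (S : Fin n → Bool) → GAdmissible n s (ceilFrac a b) (cutColouring G S)
cutColouring-admissible a b G 4≤n (Ks-free , independence-below) S =
  KFree-mono (redOrPurple⇒Adj G S) Ks-free ,
  -- α(G) exists only up to double negation, which suffices as K_t-freeness is a negation.
  λ clique → ¬¬-IsIndepNum G λ (α , α-indep) →
    cutColouring-blueOrPurple-free G S (proj₂ α-indep)
      (IndepBelow⇒2*<ceilFrac {α = α} a b 4≤n (independence-below α α-indep)) clique

RT-≤-2*g : ∀ {s n r v} a b → 4 ≤ n → IsRT s n a b r → IsG n s (ceilFrac a b) v → r ≤ 2 * v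
RT-≤-2*g {v = v} a b 4≤n ((G , admissible , refl) , _) (_ , maximal) = begin
  edges G                             ≤⟨ countPairs-≤-2*cut (adj G) ⟩
  2 * countPairs (cut (adj G) S)      ≡⟨ cong (2 *_) (purpleCount-cutColouring G S) ⟨
  2 * purpleCount (cutColouring G S)
    ≤⟨ *-monoʳ-≤ 2 (maximal (cutColouring G S) (cutColouring-admissible a b G 4≤n admissible S)) ⟩
  2 * v                               ∎
  where
  open ≤-Reasoning
  S : Fin _ → Bool
  S = greedyCut (adj G)

theorem1p6 : ∃[ pn ] ∃[ pd ] (∀ s → 3 ≤ s → ∃[ N ] (∀ n → N ≤ n →
    ∀ (a b : ℕ) → (∀ m → IsInvRamsey s n m → n ^ (m * suc b) ≤ 2 ^ a) → a ≤ n * suc b →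
    ∀ r v → IsRT s n a b r → IsG n s (ceilFrac a b) v →
    suc pn * r ≤ suc pd * v))
theorem1p6 = 0 , 1 , λ s _ → 4 , λ n 4≤n a b _ _ r v rt g →
  subst (_≤ 2 * v) (≡.sym (*-identityˡ r)) (RT-≤-2*g a b 4≤n rt g)
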